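{- Let $q\ge 2$ and $n\geq 2$ be integers and let $\mathbf{u}=(u_0,u_1,\ldots,u_{n-1})\in\mathbb{Z}_q^n$ be both symmetric and $(n-2)$-symmetric. Then: if $n$ is even, $\mathbf{u}$ is uniform; and if $n$ is odd, $\mathbf{u}$ is either uniform or alternating.
   Context: For $m\le n$, an $n$-tuple $\mathbf{u}=(u_0,\dots,u_{n-1})$ over $\mathbb{Z}_q$ is called $m$-symmetric if $u_i=u_{m-1-i}$ for every $i$ with $0\le i\le m-1$ (for $m=0$ this condition is vacuous); it is called symmetric if it is $n$-symmetric. An $n$-tuple is uniform if there is $c\in\mathbb{Z}_q$ with $u_i=c$ for all $i$. An $n$-tuple is alternating if $u_0\neq u_1$, $u_{2i}=u_0$ for all $i$ with $0\le 2i\le n-1$, and $u_{2i+1}=u_1$ for all $i$ with $0\le 2i+1\le n-1$. -}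

module Defs where

open import Data.Nat using (ℕ; _+_; _%_; _≤_)
open import Data.Nat as ℕ using ()
open import Data.Fin using (Fin; toℕ; zero; suc)
open import Relation.Binary.PropositionalEquality using (_≡_; _≢_)
open import Data.Product using (Σ; _×_)

Tuple : ℕ → ℕ → Set
Tuple q n = Fin n → Fin q

-- m-symmetric: u_i = u_{m-1-i} for all 0 ≤ i ≤ m-1.
-- Written as: for all indices i, j with i + j + 1 = m, u_i = u_j
-- (j is exactly m-1-i; vacuous for m = 0).
MSymmetric : {q n : ℕ} → ℕ → Tuple q n → Set
MSymmetric {n = n} m u = m ≤ n × ((i j : Fin n) → toℕ i + toℕ j + 1 ≡ m → u i ≡ u j)

Symmetric : {q n : ℕ} → Tuple q n → Set
Symmetric {n = n} u = MSymmetric n u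

Uniform : {q n : ℕ} → Tuple q n → Set
Uniform {q} {n} u = Σ (Fin q) λ c → (i : Fin n) → u i ≡ c

-- Alternating (defined for tuples of length ≥ 2, so that u_0 and u_1 exist).
Alternating : {q k : ℕ} → Tuple q (ℕ.suc (ℕ.suc k)) → Set
Alternating {k = k} u =
  (u zero ≢ u (suc zero)) ×
  ((i : Fin (ℕ.suc (ℕ.suc k))) →
     (toℕ i % 2 ≡ 0 → u i ≡ u zero) × (toℕ i % 2 ≡ 1 → u i ≡ u (suc zero)))

{-# OPTIONS --safe #-}
-- Reflecting an index through the centre of the window [0, n) and then back
-- through the centre of [0, n - 2) shifts it by 2, so u is 2-periodic and u_i
-- depends only on the parity of i.  For even n the symmetry u_0 = u_{n-1}
-- links the two parity classes, forcing u to be uniform.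
module Submission where

open import Defs
open import Data.Nat using (ℕ; zero; suc; _+_; _*_; _%_; _/_; _<_; _≤_; _≥_; NonZero; s≤s)
open import Data.Nat.DivMod using (m≡m%n+[m/n]*n)
open import Data.Nat.Properties
  using (+-comm; +-identityʳ; +-cancelʳ-<; m≤n+m; m≤m+n; <-≤-trans; ≤-<-trans; m≤n⇒∃[o]m+o≡n)
open import Data.Nat.Tactic.RingSolver using (solve-∀)
open import Data.Fin as Fin using (Fin; toℕ; fromℕ; fromℕ<; _≟_)
open import Data.Fin.Properties using (toℕ-injective; toℕ-fromℕ; toℕ-fromℕ<; toℕ<n)
open import Data.Sum using (_⊎_; inj₁; inj₂; [_,_]′)
open import Data.Product using (Σ-syntax; _×_; _,_; proj₁; proj₂)
open import Relation.Binary.PropositionalEquality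
  using (_≡_; refl; sym; trans; cong; subst; module ≡-Reasoning)
open import Relation.Nullary using (yes; no)

open ≡-Reasoning

m%2≡0⊎m%2≡1 : ∀ m → m % 2 ≡ 0 ⊎ m % 2 ≡ 1
m%2≡0⊎m%2≡1 zero          = inj₁ refl
m%2≡0⊎m%2≡1 (suc zero)    = inj₂ refl
m%2≡0⊎m%2≡1 (suc (suc m)) = m%2≡0⊎m%2≡1 m

[1+m]%2≡0⇒m%2≡1 : ∀ m → suc m % 2 ≡ 0 → m % 2 ≡ 1
[1+m]%2≡0⇒m%2≡1 (suc zero)    _ = refl
[1+m]%2≡0⇒m%2≡1 (suc (suc m)) e = [1+m]%2≡0⇒m%2≡1 m e

Periodic : {q n : ℕ} → ℕ → Tuple q n → Set
Periodic d u = ∀ i j → toℕ j ≡ toℕ i + d → u j ≡ u i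

mirror : ∀ {n m} (i : Fin n) → toℕ i < m → m ≤ n → Σ[ a ∈ Fin n ] toℕ i + toℕ a + 1 ≡ m
mirror {n} {m} i i<m m≤n with o , 1+i+o≡m ← m≤n⇒∃[o]m+o≡n i<m =
  fromℕ< o<n , (begin
    toℕ i + toℕ (fromℕ< o<n) + 1 ≡⟨ cong (λ x → toℕ i + x + 1) (toℕ-fromℕ< o<n) ⟩
    toℕ i + o + 1                ≡⟨ +-comm (toℕ i + o) 1 ⟩
    suc (toℕ i + o)              ≡⟨ 1+i+o≡m ⟩
    m                            ∎)
  where
  o<n : o < n
  o<n = <-≤-trans (subst (o <_) 1+i+o≡m (s≤s (m≤n+m o (toℕ i)))) m≤n

msymmetric⇒shift : ∀ {q n m} d {u : Tuple q n} → MSymmetric m u → MSymmetric (d + m) u →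
                   ∀ i j → toℕ i < m → toℕ j ≡ toℕ i + d → u j ≡ u i
msymmetric⇒shift {m = m} d (m≤n , sym-m) (_ , sym-d+m) i j i<m j≡i+d
  with a , i+a+1≡m ← mirror i i<m m≤n =
  trans (sym-d+m j a j+a+1≡d+m) (sym (sym-m i a i+a+1≡m))
  where
  rearrange : ∀ x y z → x + y + z + 1 ≡ y + (x + z + 1)
  rearrange = solve-∀

  j+a+1≡d+m : toℕ j + toℕ a + 1 ≡ d + m
  j+a+1≡d+m = begin
    toℕ j + toℕ a + 1       ≡⟨ cong (λ x → x + toℕ a + 1) j≡i+d ⟩
    toℕ i + d + toℕ a + 1   ≡⟨ rearrange (toℕ i) d (toℕ a) ⟩
    d + (toℕ i + toℕ a + 1) ≡⟨ cong (d +_) i+a+1≡m ⟩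
    d + m                   ∎

symmetric∧msymmetric⇒periodic : ∀ {q k} {u : Tuple q (suc (suc k))} →
                                Symmetric u → MSymmetric k u → Periodic 2 u
symmetric∧msymmetric⇒periodic {k = k} sym-n sym-k i j j≡i+2 =
  msymmetric⇒shift 2 sym-k sym-n i j i<k j≡i+2
  where
  i<k : toℕ i < k
  i<k = +-cancelʳ-< 2 (toℕ i) k
          (subst (_< k + 2) j≡i+2 (subst (toℕ j <_) (+-comm 2 k) (toℕ<n j)))

periodic⇒periodic-* : ∀ {q n d} {u : Tuple q n} → Periodic d u → ∀ t → Periodic (t * d) u
periodic⇒periodic-* _ zero i j j≡i+0 = cong _ (toℕ-injective (trans j≡i+0 (+-identityʳ (toℕ i))))
periodic⇒periodic-* {n = n} {d} per (suc t) i j j≡i+d+td =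
  trans (per k j j≡k+d) (periodic⇒periodic-* per t i k (toℕ-fromℕ< k<n))
  where
  regroup : ∀ x y z → x + (y + z) ≡ x + z + y
  regroup = solve-∀

  i+td+d≡j : toℕ i + t * d + d ≡ toℕ j
  i+td+d≡j = sym (trans j≡i+d+td (regroup (toℕ i) d (t * d)))

  k<n : toℕ i + t * d < n
  k<n = ≤-<-trans (m≤m+n _ d) (subst (_< n) (sym i+td+d≡j) (toℕ<n j))

  k : Fin n
  k = fromℕ< k<n

  j≡k+d : toℕ j ≡ toℕ k + d
  j≡k+d = trans (sym i+td+d≡j) (cong (_+ d) (sym (toℕ-fromℕ< k<n)))

periodic⇒≡-mod : ∀ {q n d} .{{_ : NonZero d}} {u : Tuple q n} → Periodic d u →
                 ∀ i j → toℕ i ≡ toℕ j % d → u j ≡ u i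
periodic⇒≡-mod {d = d} per i j i≡j%d = periodic⇒periodic-* per (toℕ j / d) i j (begin
  toℕ j                     ≡⟨ m≡m%n+[m/n]*n (toℕ j) d ⟩
  toℕ j % d + toℕ j / d * d ≡⟨ cong (_+ toℕ j / d * d) (sym i≡j%d) ⟩
  toℕ i + toℕ j / d * d     ∎)

module _ {q k : ℕ} {u : Tuple q (suc (suc k))} (per : Periodic 2 u) where

  periodic-2⇒≡-parity : ∀ i → (toℕ i % 2 ≡ 0 → u i ≡ u Fin.zero)
                            × (toℕ i % 2 ≡ 1 → u i ≡ u (Fin.suc Fin.zero))
  periodic-2⇒≡-parity i = (λ e → periodic⇒≡-mod per Fin.zero i (sym e))
                        , (λ e → periodic⇒≡-mod per (Fin.suc Fin.zero) i (sym e))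

  periodic-2⇒uniform : u Fin.zero ≡ u (Fin.suc Fin.zero) → Uniform u
  periodic-2⇒uniform u₀≡u₁ = u Fin.zero , λ i →
    [ proj₁ (periodic-2⇒≡-parity i) , (λ e → trans (proj₂ (periodic-2⇒≡-parity i) e) (sym u₀≡u₁)) ]′
      (m%2≡0⊎m%2≡1 (toℕ i))

  periodic-2⇒uniform⊎alternating : Uniform u ⊎ Alternating u
  periodic-2⇒uniform⊎alternating with u Fin.zero ≟ u (Fin.suc Fin.zero)
  ... | yes u₀≡u₁ = inj₁ (periodic-2⇒uniform u₀≡u₁)
  ... | no  u₀≢u₁ = inj₂ (u₀≢u₁ , periodic-2⇒≡-parity)

symmetric⇒first≡last : ∀ {q n} {u : Tuple q (suc n)} → Symmetric u → u Fin.zero ≡ u (fromℕ n)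
symmetric⇒first≡last {n = n} (_ , sym-n) =
  sym-n Fin.zero (fromℕ n) (trans (cong (_+ 1) (toℕ-fromℕ n)) (+-comm n 1))

lemma4 : (q k : ℕ) → q ≥ 2 → (u : Tuple q (suc (suc k))) →
    Symmetric u → MSymmetric k u →
    (suc (suc k) % 2 ≡ 0 → Uniform u) × (suc (suc k) % 2 ≡ 1 → Uniform u ⊎ Alternating u)
lemma4 _ k _ u sym-n sym-k = even , λ _ → periodic-2⇒uniform⊎alternating per
  where
  per : Periodic 2 u
  per = symmetric∧msymmetric⇒periodic sym-n sym-k

  even : suc (suc k) % 2 ≡ 0 → Uniform u
  even n%2≡0 = periodic-2⇒uniform per (trans (symmetric⇒first≡last sym-n) u-last≡u₁)
    where
    u-last≡u₁ : u (fromℕ (suc k)) ≡ u (Fin.suc Fin.zero)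
    u-last≡u₁ = periodic⇒≡-mod per (Fin.suc Fin.zero) (fromℕ (suc k))
      (sym (trans (cong (_% 2) (toℕ-fromℕ (suc k))) ([1+m]%2≡0⇒m%2≡1 (suc k) n%2≡0)))
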